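{- Let $\pi$ be a lex model and let $\varphi$ be a non-strict element of $\mathcal{L}_{pqT}$. Call $X\in V_\pi$ definite if $X\in(R_\varphi\cap S_\varphi)\cup W_\varphi$, and relevant if $X\in R_\varphi\cup S_\varphi\cup W_\varphi$ and no variable of $V_\pi$ occurring earlier than $X$ in $\pi$ is definite. Let $\ge_X$ denote the order associated with $X$ in $\pi$. Then $\pi\models\varphi$ if and only if for every relevant variable $X$: (a) $X\notin W_\varphi$; (b) if $X\in R_\varphi\cap S_\varphi$ then $r_\varphi(X)>_X s_\varphi(X)$; (c) if $X\in R_\varphi\setminus S_\varphi$ then $r_\varphi(X)\ge_X x$ for all $x\in\underline{X}$; (d) if $X\in S_\varphi\setminus R_\varphi$ then $x\ge_X s_\varphi(X)$ for all $x\in\underline{X}$. In particular, if $V_\pi\subseteq T_\varphi\cup U_\varphi$ then $\pi\models\varphi$.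
   Context: Let $V$ be a finite set of variables with finite nonempty domains $\underline{X}$; $\underline{A}=\prod_{X\in A}\underline{X}$; outcomes are elements of $\underline{V}$; $\alpha(U)$ is restriction. A lex model $\pi$ is a (possibly empty) sequence $(Y_1,\ge_{Y_1}),\ldots,(Y_k,\ge_{Y_k})$ of pairwise distinct variables each with a total order on its domain; $V_\pi=\{Y_1,\dots,Y_k\}$; $Y_j$ occurs earlier than $Y_i$ if $j<i$. $\alpha\succ_\pi\beta$ iff for some $i$, $\alpha(Y_j)=\beta(Y_j)$ for $j<i$ and $\alpha(Y_i)>_{Y_i}\beta(Y_i)$ strictly; $\alpha\equiv_\pi\beta$ iff $\alpha(V_\pi)=\beta(V_\pi)$; $\alpha\succcurlyeq_\pi\beta$ iff $\alpha\succ_\pi\beta$ or $\alpha\equiv_\pi\beta$. A non-strict statement $\varphi$ of $\mathcal{L}_{pqT}$ consists of pairwise disjoint sets $U_\varphi,T_\varphi,R_\varphi\cup S_\varphi\subseteq V$ and assignments $u_\varphi\in\underline{U_\varphi}$, $r_\varphi\in\underline{R_\varphi}$, $s_\varphi\in\underline{S_\varphi}$ with $r_\varphi(Y)\ne s_\varphi(Y)$ for all $Y\in R_\varphi\cap S_\varphi$, every variable with a one-element domain lying in $T_\varphi$; written $u_\varphi r_\varphi\ge u_\varphi s_\varphi\parallel T_\varphi$. $W_\varphi=V\setminus(R_\varphi\cup S_\varphi\cup T_\varphi\cup U_\varphi)$. $\varphi^*$ is the set of pairs $(\alpha,\beta)$ of outcomes with $\alpha$ extending $u_\varphi$ and $r_\varphi$,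 $\beta$ extending $u_\varphi$ and $s_\varphi$, and $\alpha(T_\varphi)=\beta(T_\varphi)$; $\pi\models\varphi$ iff $\alpha\succcurlyeq_\pi\beta$ for all $(\alpha,\beta)\in\varphi^*$. -}

module Defs where

open import Level using (0ℓ)
open import Data.Nat using (ℕ)
open import Data.Fin using (Fin; _<_)
open import Data.Fin.Subset using (Subset; _∈_; _∉_)
open import Data.List using (List; length; lookup)
open import Data.Product using (Σ; ∃-syntax; _×_; proj₁; proj₂)
open import Data.Sum using (_⊎_)
open import Relation.Nullary using (¬_)
open import Relation.Binary.Core using (Rel)
open import Relation.Binary.Structures using (IsTotalOrder)
open import Relation.Binary.PropositionalEquality using (_≡_; _≢_)

-- Variables V = Fin n; the domain of variable X is Fin (d X).
module _ {n : ℕ} (d : Fin n → ℕ) where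

  Outcome : Set
  Outcome = (X : Fin n) → Fin (d X)

  PAssign : Subset n → Set
  PAssign A = (X : Fin n) → X ∈ A → Fin (d X)

  Extends : Outcome → {A : Subset n} → PAssign A → Set
  Extends α {A} a = (X : Fin n) (p : X ∈ A) → α X ≡ a X p

  Strict : {k : ℕ} → Rel (Fin k) 0ℓ → Fin k → Fin k → Set
  Strict ge a b = ge a b × a ≢ b

  record LexModel : Set₁ where
    field
      entries : List (Σ (Fin n) (λ Y → Rel (Fin (d Y)) 0ℓ))
    Pos : Set
    Pos = Fin (length entries)
    var : Pos → Fin n
    var i = proj₁ (lookup entries i)
    ord : (i : Pos) → Rel (Fin (d (var i))) 0ℓ
    ord i = proj₂ (lookup entries i)
    field
      total    : (i : Pos) → IsTotalOrder _≡_ (ord i)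
      distinct : (i j : Pos) → var i ≡ var j → i ≡ j

  -- A non-strict statement u r ≥ u s ∥ T of L_pqT.
  record Stmt : Set where
    field
      U T R S : Subset n
      u : PAssign U
      r : PAssign R
      s : PAssign S
      disjUT : (X : Fin n) → X ∈ U → X ∉ T
      disjUR : (X : Fin n) → X ∈ U → X ∉ R
      disjUS : (X : Fin n) → X ∈ U → X ∉ S
      disjTR : (X : Fin n) → X ∈ T → X ∉ R
      disjTS : (X : Fin n) → X ∈ T → X ∉ S
      rs-diff : (X : Fin n) (p : X ∈ R) (q : X ∈ S) → r X p ≢ s X q
      unary-in-T : (X : Fin n) → d X ≡ 1 → X ∈ T

  open LexModel
  open Stmt

  _≻[_]_ : Outcome → LexModel → Outcome → Set
  α ≻[ π ] β = ∃[ i ] ((∀ j → j < i → α (var π j) ≡ β (var π j))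
                       × Strict (ord π i) (α (var π i)) (β (var π i)))

  _≡[_]_ : Outcome → LexModel → Outcome → Set
  α ≡[ π ] β = ∀ i → α (var π i) ≡ β (var π i)

  _≽[_]_ : Outcome → LexModel → Outcome → Set
  α ≽[ π ] β = (α ≻[ π ] β) ⊎ (α ≡[ π ] β)

  InStar : Stmt → Outcome → Outcome → Set
  InStar φ α β = Extends α (u φ) × Extends α (r φ) × Extends β (u φ) × Extends β (s φ)
                 × ((X : Fin n) → X ∈ T φ → α X ≡ β X)

  _⊨_ : LexModel → Stmt → Set
  π ⊨ φ = (α β : Outcome) → InStar φ α β → α ≽[ π ] β

  InW : Stmt → Fin n → Set
  InW φ X = X ∉ R φ × X ∉ S φ × X ∉ T φ × X ∉ U φ

  Definite : Stmt → Fin n → Set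
  Definite φ X = (X ∈ R φ × X ∈ S φ) ⊎ InW φ X

  Relevant : (π : LexModel) → Stmt → Pos π → Set
  Relevant π φ i = (var π i ∈ R φ ⊎ var π i ∈ S φ ⊎ InW φ (var π i))
                   × (∀ j → j < i → ¬ Definite φ (var π j))

  Conditions : (π : LexModel) → Stmt → Pos π → Set
  Conditions π φ i =
      (¬ InW φ X)
    × ((p : X ∈ R φ) (q : X ∈ S φ) → Strict (ord π i) (r φ X p) (s φ X q))
    × ((p : X ∈ R φ) → X ∉ S φ → (x : Fin (d X)) → ord π i (r φ X p) x)
    × ((q : X ∈ S φ) → X ∉ R φ → (x : Fin (d X)) → ord π i x (s φ X q))
    where X = var π i

{-# OPTIONS --safe #-}
-- Complete u r and u s to outcomes α₀ and β₀ by filling R \ S with r, S \ R with s and all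
-- remaining variables with a common default; they differ only on R ∩ S. No variable before a
-- relevant X is definite, so α₀ and β₀, and their variants that are changed only at X and still
-- lie in φ*, agree before X; π ⊨ φ then forces ≥_X between their values at X, giving (a)–(d).
-- Conversely, a pair of φ* that is not π-equivalent first differs at a relevant variable, and
-- (b)–(d) make it π-greater there.
module Submission where

open import Defs
open import Data.Nat using (ℕ; _<_)
open import Data.Fin using (Fin)
open import Data.Fin.Subset using (_∈_)
open import Data.Product using (_×_)
open import Data.Sum using (_⊎_)
open import Function.Bundles using (_⇔_)

open import Level using (0ℓ)
open import Data.Nat using (zero; suc)
open import Data.List using (length)
open import Data.Fin using (zero; suc; fromℕ<; inject) renaming (_<_ to _<ᶠ_)
open import Data.Fin.Properties
  using (_≟_; <-cmp; <-irrefl; <-trans; all?; ¬∀⟶∃¬-smallest; toℕ-injective; toℕ-inject; toℕ-fromℕ<)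
open import Data.Fin.Induction using (<-wellFounded)
open import Data.Fin.Subset using (Subset; _∉_)
open import Data.Fin.Subset.Properties using (_∈?_)
open import Data.Vec.Properties.WithK using ([]=-irrelevant)
open import Data.Product using (∃; ∃₂; _,_; proj₁; proj₂)
open import Data.Sum using (inj₁; inj₂; [_,_])
open import Data.Empty using (⊥-elim)
open import Function.Base using (_∘_)
open import Function.Bundles using (mk⇔)
open import Induction.WellFounded using (WfRec; module All)
open import Relation.Nullary using (¬_; Dec; yes; no; contradiction)
open import Relation.Binary.Structures using (IsTotalOrder)
open import Relation.Binary.Definitions using (tri<; tri≈; tri>)
open import Relation.Binary.PropositionalEquality
  using (_≡_; _≢_; refl; sym; trans; cong; subst; subst₂)

inject-fromℕ< : ∀ {m} {i j : Fin m} (j<i : j <ᶠ i) → inject (fromℕ< j<i) ≡ j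
inject-fromℕ< j<i = toℕ-injective (trans (toℕ-inject _) (toℕ-fromℕ< j<i))

distinct-pair : ∀ {m} → 0 < m → m ≢ 1 → ∃₂ λ (a b : Fin m) → a ≢ b
distinct-pair {suc zero}    _ m≢1 = contradiction refl m≢1
distinct-pair {suc (suc _)} _ _   = zero , suc zero , λ ()

module _ {n : ℕ} {d : Fin n → ℕ} where

  override : {A : Subset n} → PAssign d A → Outcome d → Outcome d
  override {A} a γ Y with Y ∈? A
  ... | yes p = a Y p
  ... | no  _ = γ Y

  override-∈ : {A : Subset n} (a : PAssign d A) (γ : Outcome d) → Extends d (override a γ) a
  override-∈ {A} a γ Y p with Y ∈? A
  ... | yes q = cong (a Y) ([]=-irrelevant q p)
  ... | no ¬p = contradiction p ¬p

  override-∉ : {A : Subset n} (a : PAssign d A) (γ : Outcome d) {Y : Fin n} →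
               Y ∉ A → override a γ Y ≡ γ Y
  override-∉ {A} a γ {Y} Y∉A with Y ∈? A
  ... | yes p = contradiction p Y∉A
  ... | no  _ = refl

  override-cong : {A : Subset n} (a : PAssign d A) {γ δ : Outcome d} {Y : Fin n} →
                  γ Y ≡ δ Y → override a γ Y ≡ override a δ Y
  override-cong {A} a {Y = Y} γY≡δY with Y ∈? A
  ... | yes _ = refl
  ... | no  _ = γY≡δY

  override-comm : {A B : Subset n} (a : PAssign d A) (b : PAssign d B) (γ : Outcome d) {Y : Fin n} →
                  ¬ (Y ∈ A × Y ∈ B) → override a (override b γ) Y ≡ override b (override a γ) Y
  override-comm {A} {B} a b γ {Y} ¬AB with Y ∈? A | Y ∈? B
  ... | yes p | yes q = contradiction (p , q) ¬AB
  ... | yes p | no  _ = sym (override-∈ a γ Y p)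
  ... | no  _ | yes q = override-∈ b γ Y q
  ... | no  p | no  q = trans (override-∉ b γ q) (sym (override-∉ a γ p))

  _[_≔_] : Outcome d → (X : Fin n) → Fin (d X) → Outcome d
  (γ [ X ≔ x ]) Y with Y ≟ X
  ... | yes refl = x
  ... | no  _    = γ Y

  [≔]-same : (γ : Outcome d) (X : Fin n) (x : Fin (d X)) → (γ [ X ≔ x ]) X ≡ x
  [≔]-same γ X x with X ≟ X
  ... | yes refl = refl
  ... | no  X≢X  = contradiction refl X≢X

  [≔]-other : (γ : Outcome d) {X Y : Fin n} (x : Fin (d X)) → Y ≢ X → (γ [ X ≔ x ]) Y ≡ γ Y
  [≔]-other γ {X} {Y} x Y≢X with Y ≟ X
  ... | yes refl = contradiction refl Y≢X
  ... | no  _    = refl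

  Extends-[≔] : {A : Subset n} (a : PAssign d A) {γ : Outcome d} {X : Fin n} {x : Fin (d X)} →
                Extends d γ a → X ∉ A → Extends d (γ [ X ≔ x ]) a
  Extends-[≔] _ γ⊇a X∉A Y p = trans ([≔]-other _ _ λ { refl → X∉A p }) (γ⊇a Y p)

module _ {n : ℕ} {d : Fin n → ℕ} (π : LexModel d) where
  open LexModel π

  AgreeBefore : Pos → Outcome d → Outcome d → Set
  AgreeBefore i α β = ∀ j → j <ᶠ i → α (var j) ≡ β (var j)

  ≽⇒≥-at : (i : Pos) {α β : Outcome d} → _≽[_]_ d α π β → AgreeBefore i α β →
           ord i (α (var i)) (β (var i))
  ≽⇒≥-at i (inj₂ α≡β) _ = IsTotalOrder.reflexive (total i) (α≡β i)
  ≽⇒≥-at i (inj₁ (k , before , α>β)) agree with <-cmp k i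
  ... | tri< k<i _ _ = contradiction (agree k k<i) (proj₂ α>β)
  ... | tri≈ _ refl _ = proj₁ α>β
  ... | tri> _ _ i<k = IsTotalOrder.reflexive (total i) (before i i<k)

  agree-at? : (α β : Outcome d) (i : Pos) → Dec (α (var i) ≡ β (var i))
  agree-at? α β i = α (var i) ≟ β (var i)

  first-disagreement : (α β : Outcome d) →
                       _≡[_]_ d α π β ⊎ ∃ λ i → α (var i) ≢ β (var i) × AgreeBefore i α β
  first-disagreement α β with all? (agree-at? α β)
  ... | yes α≡β = inj₁ α≡β
  ... | no ¬α≡β with ¬∀⟶∃¬-smallest _ _ (agree-at? α β) ¬α≡β
  ...   | i , α≢β , before = inj₂ (i , α≢β , λ j j<i →
            subst (λ k → α (var k) ≡ β (var k)) (inject-fromℕ< j<i) (before (fromℕ< j<i)))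

module _ {n : ℕ} {d : Fin n → ℕ} (φ : Stmt d) where
  open Stmt φ

  InR∪S∪W : Fin n → Set
  InR∪S∪W X = X ∈ R ⊎ X ∈ S ⊎ InW d φ X

  InR∪S∪W⇒∉T∪U : ∀ {X} → InR∪S∪W X → ¬ (X ∈ T ⊎ X ∈ U)
  InR∪S∪W⇒∉T∪U (inj₁ p)                         = [ (λ t → disjTR _ t p) , (λ q → disjUR _ q p) ]
  InR∪S∪W⇒∉T∪U (inj₂ (inj₁ p))                  = [ (λ t → disjTS _ t p) , (λ q → disjUS _ q p) ]
  InR∪S∪W⇒∉T∪U (inj₂ (inj₂ (_ , _ , X∉T , X∉U))) = [ X∉T , X∉U ]

  InStar⇒agree-on-T∪U : ∀ {α β Y} → InStar d φ α β → Y ∈ T ⊎ Y ∈ U → α Y ≡ β Y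
  InStar⇒agree-on-T∪U (_ , _ , _ , _ , α≡βonT) (inj₁ t) = α≡βonT _ t
  InStar⇒agree-on-T∪U (α⊇u , _ , β⊇u , _ , _)  (inj₂ p) = trans (α⊇u _ p) (sym (β⊇u _ p))

  InStar⇒disagree-on-R∩S : ∀ {α β Y} → InStar d φ α β → Y ∈ R → Y ∈ S → α Y ≢ β Y
  InStar⇒disagree-on-R∩S (_ , α⊇r , _ , β⊇s , _) p q α≡β =
    rs-diff _ p q (trans (sym (α⊇r _ p)) (trans α≡β (β⊇s _ q)))

  InStar-updateˡ : ∀ {α β X} (x : Fin (d X)) → X ∉ U → X ∉ R → X ∉ T →
                   InStar d φ α β → InStar d φ (α [ X ≔ x ]) β
  InStar-updateˡ {α} x X∉U X∉R X∉T (α⊇u , α⊇r , β⊇u , β⊇s , α≡βonT) =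
    Extends-[≔] u α⊇u X∉U , Extends-[≔] r α⊇r X∉R , β⊇u , β⊇s ,
    λ Y t → trans ([≔]-other α x λ { refl → X∉T t }) (α≡βonT Y t)

  InStar-updateʳ : ∀ {α β X} (x : Fin (d X)) → X ∉ U → X ∉ S → X ∉ T →
                   InStar d φ α β → InStar d φ α (β [ X ≔ x ])
  InStar-updateʳ {β = β} x X∉U X∉S X∉T (α⊇u , α⊇r , β⊇u , β⊇s , α≡βonT) =
    α⊇u , α⊇r , Extends-[≔] u β⊇u X∉U , Extends-[≔] s β⊇s X∉S ,
    λ Y t → trans (α≡βonT Y t) (sym ([≔]-other β x λ { refl → X∉T t }))

module CanonicalPair {n : ℕ} {d : Fin n → ℕ} (pos : (X : Fin n) → 0 < d X) (φ : Stmt d) where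
  open Stmt φ

  default : Outcome d
  default X = fromℕ< (pos X)

  α₀ β₀ : Outcome d
  α₀ = override u (override r (override s default))
  β₀ = override u (override s (override r default))

  α₀⊇r : Extends d α₀ r
  α₀⊇r Y p = trans (override-∉ u _ (λ q → disjUR Y q p)) (override-∈ r _ Y p)

  β₀⊇s : Extends d β₀ s
  β₀⊇s Y q = trans (override-∉ u _ (λ p → disjUS Y p q)) (override-∈ s _ Y q)

  α₀≡β₀ : ∀ {Y} → ¬ (Y ∈ R × Y ∈ S) → α₀ Y ≡ β₀ Y
  α₀≡β₀ ¬RS = override-cong u (override-comm r s default ¬RS)

  α₀β₀∈φ* : InStar d φ α₀ β₀
  α₀β₀∈φ* = override-∈ u _ , α₀⊇r , override-∈ u _ , β₀⊇s ,
            λ Y t → α₀≡β₀ (λ (p , _) → disjTR Y t p)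

module Necessity {n : ℕ} {d : Fin n → ℕ} (pos : (X : Fin n) → 0 < d X)
                 (π : LexModel d) (φ : Stmt d) (π⊨φ : _⊨_ d π φ)
                 {i : LexModel.Pos π} (rel : Relevant d π φ i) where
  open LexModel π
  open Stmt φ
  open CanonicalPair pos φ
  open IsTotalOrder (total i) using (antisym)

  X : Fin n
  X = var i

  X∉T : X ∉ T
  X∉T = InR∪S∪W⇒∉T∪U φ (proj₁ rel) ∘ inj₁

  X∉U : X ∉ U
  X∉U = InR∪S∪W⇒∉T∪U φ (proj₁ rel) ∘ inj₂

  ≥-at-X : ∀ {α β} → InStar d φ α β → (∀ {Y} → Y ≢ X → α Y ≡ α₀ Y) → (∀ {Y} → Y ≢ X → β Y ≡ β₀ Y) →
           ord i (α X) (β X)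
  ≥-at-X {α} {β} αβ∈φ* α≈α₀ β≈β₀ = ≽⇒≥-at π i {α} {β} (π⊨φ α β αβ∈φ*) λ j j<i →
    let varⱼ≢X : var j ≢ X
        varⱼ≢X Y≡X = <-irrefl (distinct j i Y≡X) j<i
    in trans (α≈α₀ varⱼ≢X) (trans (α₀≡β₀ (proj₂ rel j j<i ∘ inj₁)) (sym (β≈β₀ varⱼ≢X)))

  ∉W : ¬ InW d φ X
  ∉W (X∉R , X∉S , _) =
    let a , b , a≢b = distinct-pair (pos X) (X∉T ∘ unary-in-T X)
    in a≢b (antisym (all-≥ a b) (all-≥ b a))
    where
      all-≥ : ∀ x y → ord i x y
      all-≥ x y = subst₂ (ord i) ([≔]-same α₀ X x) ([≔]-same β₀ X y)
        (≥-at-X (InStar-updateˡ φ x X∉U X∉R X∉T (InStar-updateʳ φ y X∉U X∉S X∉T α₀β₀∈φ*))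
                ([≔]-other α₀ x) ([≔]-other β₀ y))

  r>s : (p : X ∈ R) (q : X ∈ S) → Strict d (ord i) (r X p) (s X q)
  r>s p q = subst₂ (ord i) (α₀⊇r X p) (β₀⊇s X q) (≥-at-X α₀β₀∈φ* (λ _ → refl) (λ _ → refl)) , rs-diff X p q

  r-greatest : (p : X ∈ R) → X ∉ S → (x : Fin (d X)) → ord i (r X p) x
  r-greatest p X∉S x = subst₂ (ord i) (α₀⊇r X p) ([≔]-same β₀ X x)
    (≥-at-X (InStar-updateʳ φ x X∉U X∉S X∉T α₀β₀∈φ*) (λ _ → refl) ([≔]-other β₀ x))

  s-least : (q : X ∈ S) → X ∉ R → (x : Fin (d X)) → ord i x (s X q)
  s-least q X∉R x = subst₂ (ord i) ([≔]-same α₀ X x) (β₀⊇s X q)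
    (≥-at-X (InStar-updateˡ φ x X∉U X∉R X∉T α₀β₀∈φ*) ([≔]-other α₀ x) (λ _ → refl))

  conditions : Conditions d π φ i
  conditions = ∉W , r>s , r-greatest , s-least

module Sufficiency {n : ℕ} {d : Fin n → ℕ} (π : LexModel d) (φ : Stmt d)
                   (cond : (i : LexModel.Pos π) → Relevant d π φ i → Conditions d π φ i)
                   {α β : Outcome d} (αβ∈φ* : InStar d φ α β) where
  open LexModel π
  open Stmt φ
  open All (<-wellFounded {length entries}) 0ℓ using (wfRec)

  α⊇r : Extends d α r
  α⊇r = proj₁ (proj₂ αβ∈φ*)

  β⊇s : Extends d β s
  β⊇s = proj₁ (proj₂ (proj₂ (proj₂ αβ∈φ*)))

  disagreement⇒InW : ∀ {Y} → α Y ≢ β Y → Y ∉ R → Y ∉ S → InW d φ Y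
  disagreement⇒InW α≢β Y∉R Y∉S = Y∉R , Y∉S , α≢β ∘ agree ∘ inj₁ , α≢β ∘ agree ∘ inj₂
    where agree = InStar⇒agree-on-T∪U φ αβ∈φ*

  disagreement⇒InR∪S∪W : ∀ {Y} → α Y ≢ β Y → InR∪S∪W φ Y
  disagreement⇒InR∪S∪W {Y} α≢β with Y ∈? R | Y ∈? S
  ... | yes p | _     = inj₁ p
  ... | no  _ | yes q = inj₂ (inj₁ q)
  ... | no  p | no  q = inj₂ (inj₂ (disagreement⇒InW α≢β p q))

  -- The first definite variable is relevant, so (a) leaves only R ∩ S, where α and β differ.
  no-definite-before : ∀ {i} → AgreeBefore π i α β → ∀ j → j <ᶠ i → ¬ Definite d φ (var j)
  no-definite-before {i} before = wfRec _ step
    where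
      step : ∀ j → WfRec _<ᶠ_ (λ k → k <ᶠ i → ¬ Definite d φ (var k)) j → j <ᶠ i → ¬ Definite d φ (var j)
      step j _  j<i (inj₁ (p , q)) = InStar⇒disagree-on-R∩S φ αβ∈φ* p q (before j j<i)
      step j IH j<i (inj₂ w) =
        proj₁ (cond j (inj₂ (inj₂ w) , λ k k<j → IH k<j (<-trans k<j j<i))) w

  >-at-disagreement : ∀ {i} → α (var i) ≢ β (var i) → Conditions d π φ i →
                      Strict d (ord i) (α (var i)) (β (var i))
  >-at-disagreement {i} α≢β (∉W , r>s , r-greatest , s-least) with var i ∈? R | var i ∈? S
  ... | yes p | yes q = subst₂ (Strict d (ord i)) (sym (α⊇r _ p)) (sym (β⊇s _ q)) (r>s p q)
  ... | yes p | no  q = subst (λ a → ord i a (β (var i))) (sym (α⊇r _ p)) (r-greatest p q _) , α≢β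
  ... | no  p | yes q = subst (ord i (α (var i))) (sym (β⊇s _ q)) (s-least q p _) , α≢β
  ... | no  p | no  q = contradiction (disagreement⇒InW α≢β p q) ∉W

conditions⇒⊨ : ∀ {n} {d : Fin n → ℕ} (π : LexModel d) (φ : Stmt d) →
               ((i : LexModel.Pos π) → Relevant d π φ i → Conditions d π φ i) → _⊨_ d π φ
conditions⇒⊨ π φ cond α β αβ∈φ* with first-disagreement π α β
... | inj₁ α≡β = inj₂ α≡β
... | inj₂ (i , α≢β , before) =
  inj₁ (i , before , >-at-disagreement α≢β (cond i (disagreement⇒InR∪S∪W α≢β , no-definite-before before)))
  where open Sufficiency π φ cond αβ∈φ*

⊨-if-V⊆T∪U : ∀ {n} {d : Fin n → ℕ} (π : LexModel d) (φ : Stmt d) →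
             ((i : LexModel.Pos π) → LexModel.var π i ∈ Stmt.T φ ⊎ LexModel.var π i ∈ Stmt.U φ) → _⊨_ d π φ
⊨-if-V⊆T∪U π φ V⊆T∪U = conditions⇒⊨ π φ λ i rel →
  ⊥-elim (InR∪S∪W⇒∉T∪U φ (proj₁ rel) (V⊆T∪U i))

proposition12 : {n : ℕ} (d : Fin n → ℕ) → ((X : Fin n) → 0 < d X)
    → (π : LexModel d) (φ : Stmt d)
    → ((_⊨_ d π φ) ⇔ ((i : LexModel.Pos π) → Relevant d π φ i → Conditions d π φ i))
      × (((i : LexModel.Pos π) → (LexModel.var π i ∈ Stmt.T φ) ⊎ (LexModel.var π i ∈ Stmt.U φ))
         → _⊨_ d π φ)
proposition12 d pos π φ =
  mk⇔ (λ π⊨φ i rel → Necessity.conditions pos π φ π⊨φ rel) (conditions⇒⊨ π φ) , ⊨-if-V⊆T∪U π φ
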